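{- Every $k$-uniform tight star is an edge-minimal hypertree.
   Context: Hypergraphs are finite, $k$-uniform and have no multiple edges. A chain is a nonempty $k$-uniform hypergraph admitting a sequence $v_1,\dots,v_l$ of its vertices, in which every vertex appears at least once, with $v_1\ne v_l$, such that the sets $\{v_i,\dots,v_{i+k-1}\}$ ($1\le i\le l-k+1$) are pairwise distinct and are exactly its edges; a semicycle is defined the same way but with $v_1=v_l$. A hypergraph is chain-connected if every pair of its vertices lies in some subhypergraph that is a chain, and semicycle-free if it has no subhypergraph that is a semicycle. A hypertree is a chain-connected semicycle-free $k$-uniform hypergraph; it is an edge-minimal hypertree if deleting any one of its edges (keeping the vertex set) yields a hypergraph that is not a hypertree. The $k$-uniform tight star $\mathcal{S}_n$ of order $n\ge k$ is the hypergraph on an $n$-element vertex set containing distinct vertices $u_1,\dots,u_{k-1}$ whose edges are exactly the sets $\{u_1,\dots,u_{k-1},w\}$ for all vertices $w\notin\{u_1,\dots,u_{k-1}\}$. -}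

module Defs where

open import Data.Nat using (ℕ; zero; suc; _≤_; _≤?_)
open import Data.Fin using (Fin)
open import Data.Fin.Subset using (Subset; ⊥; ⁅_⁆; _∪_; _∉_; _⊆_; ∣_∣) renaming (_∈_ to _∈ₛ_)
open import Data.List using (List; []; _∷_; take; length; map; foldr)
open import Data.List.Membership.Propositional using () renaming (_∈_ to _∈ₗ_)
open import Data.List.Relation.Unary.Unique.Propositional using (Unique)
open import Data.Product using (Σ; _×_; ∃)
open import Relation.Binary.PropositionalEquality using (_≡_; _≢_)
open import Relation.Nullary using (¬_; yes; no)
open import Function.Bundles using (_⇔_)

record Hypergraph (n : ℕ) : Set₁ where
  field
    Edge : Subset n → Set
open Hypergraph public

IsUniform : ∀ {n} → ℕ → Hypergraph n → Set
IsUniform k H = ∀ e → Edge H e → ∣ e ∣ ≡ k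

windows : ∀ {A : Set} → ℕ → List A → List (List A)
windows k [] = []
windows k (x ∷ xs) with k ≤? length (x ∷ xs)
... | yes _ = take k (x ∷ xs) ∷ windows k xs
... | no  _ = []

toSet : ∀ {n} → List (Fin n) → Subset n
toSet = foldr (λ v s → ⁅ v ⁆ ∪ s) ⊥

lastOf : ∀ {A : Set} → A → List A → A
lastOf a [] = a
lastOf _ (x ∷ xs) = lastOf x xs

record SubHypergraph {n : ℕ} (H : Hypergraph n) : Set₁ where
  field
    W : Subset n
    F : Subset n → Set
    F⊆E : ∀ e → F e → Edge H e
    F⊆W : ∀ e → F e → e ⊆ W
open SubHypergraph public

IsChain : ∀ {n} → ℕ → Subset n → (Subset n → Set) → Set
IsChain {n} k W F =
  Σ (Fin n) λ v₁ → Σ (List (Fin n)) λ rest →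
    (∀ v → (v ∈ₛ W) ⇔ (v ∈ₗ (v₁ ∷ rest)))
    × (k ≤ length (v₁ ∷ rest))
    × Unique (map toSet (windows k (v₁ ∷ rest)))
    × (∀ e → F e ⇔ (e ∈ₗ map toSet (windows k (v₁ ∷ rest))))
    × (v₁ ≢ lastOf v₁ rest)

IsSemicycle : ∀ {n} → ℕ → Subset n → (Subset n → Set) → Set
IsSemicycle {n} k W F =
  Σ (Fin n) λ v₁ → Σ (List (Fin n)) λ rest →
    (∀ v → (v ∈ₛ W) ⇔ (v ∈ₗ (v₁ ∷ rest)))
    × (k ≤ length (v₁ ∷ rest))
    × Unique (map toSet (windows k (v₁ ∷ rest)))
    × (∀ e → F e ⇔ (e ∈ₗ map toSet (windows k (v₁ ∷ rest))))
    × (v₁ ≡ lastOf v₁ rest)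

ChainConnected : ∀ {n} → ℕ → Hypergraph n → Set₁
ChainConnected {n} k H =
  ∀ (x y : Fin n) → x ≢ y →
    Σ (SubHypergraph H) λ S → (x ∈ₛ W S) × (y ∈ₛ W S) × IsChain k (W S) (F S)

SemicycleFree : ∀ {n} → ℕ → Hypergraph n → Set₁
SemicycleFree k H = ∀ (S : SubHypergraph H) → ¬ IsSemicycle k (W S) (F S)

IsHypertree : ∀ {n} → ℕ → Hypergraph n → Set₁
IsHypertree k H = ChainConnected k H × SemicycleFree k H

deleteEdge : ∀ {n} → Hypergraph n → Subset n → Hypergraph n
deleteEdge H f = record { Edge = λ e → Edge H e × e ≢ f }

IsEdgeMinimalHypertree : ∀ {n} → ℕ → Hypergraph n → Set₁
IsEdgeMinimalHypertree k H =
  IsHypertree k H × (∀ f → Edge H f → ¬ IsHypertree k (deleteEdge H f))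

tightStar : ∀ {n} → Subset n → Hypergraph n
tightStar {n} U = record { Edge = λ e → Σ (Fin n) λ w → w ∉ U × e ≡ U ∪ ⁅ w ⁆ }

-- Let U be the centre and L a listing of U, so that w ∷ L spells the edge U ∪ ⁅ w ⁆ for
-- every w ∉ U. Chain-connectedness: w ∷ L is a one-edge chain, and w₁ ∷ L ∷ʳ w₂ a
-- two-edge chain through any two distinct outer vertices. Semicycle-freeness: distinct
-- edges meet exactly in U, and the middle one of three consecutive windows of a sequence
-- lies in the union of the other two, so its outer vertex would lie in U; a sequence of
-- distinct edges therefore has at most two windows, and closing it up either repeats a
-- vertex inside the single window or makes the two windows equal as sets. Minimality:
-- deleting U ∪ ⁅ w ⁆ leaves w in no edge, while any vertex joined to another by a chain
-- lies in an edge of that chain.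
module Submission where

open import Defs
open import Data.Nat using (ℕ; zero; suc; _≤_; _<_; _∸_; z≤n; s≤s; _≤?_)
open import Data.Nat.Properties
  using (≤-refl; ≤-reflexive; ≤-trans; ≤-pred; ≮⇒≥; 1+n≰n; >⇒≢; m≤n⇒m≤1+n; m<n⇒0<n∸m; module ≤-Reasoning)
open import Data.Fin using (Fin; zero; suc)
open import Data.Fin.Subset
  using (Subset; ⁅_⁆; _∪_; _∉_; _⊆_; ∣_∣; ∁; Nonempty; inside; outside)
  renaming (_∈_ to _∈ₛ_; ⊥ to ∅)
open import Data.Fin.Subset.Properties
  using (x∈⁅x⁆; x∈⁅y⁆⇒x≡y; x∈p∪q⁻; x∈p∪q⁺; ∪-assoc; ∪-comm; ∪-identityˡ; ∪-identityʳ; ∉⊥;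
         _∈?_; nonempty?; Empty-unique; ∣⊥∣≡0; ∣∁p∣≡n∸∣p∣; x∈∁p⇒x∉p; p⊆q⇒∣p∣≤∣q∣)
open import Data.Vec using (_∷_; [])
open import Data.Vec.Base using (here; there)
open import Data.List using (List; []; _∷_; _++_; _∷ʳ_; take; length; map)
open import Data.List.Properties using (take-all; length-map; length-++-≤ˡ; length-++-sucʳ; ++-identityʳ)
open import Data.List.Relation.Unary.Any using (Any; here; there)
open import Data.List.Relation.Unary.All using ([]; _∷_)
open import Data.List.Relation.Unary.AllPairs using ([]; _∷_)
open import Data.List.Relation.Unary.Unique.Propositional using (Unique)
open import Data.List.Membership.Propositional using (find) renaming (_∈_ to _∈ₗ_)
open import Data.List.Membership.Propositional.Properties using (∈-++⁺ˡ; ∈-++⁺ʳ; ∈-++⁻; ∈-map⁺; ∈-map⁻)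
open import Data.List.Relation.Binary.Subset.Propositional using () renaming (_⊆_ to _⊆ₗ_)
open import Data.Product using (∃; ∃₂; _×_; _,_; map₂)
open import Data.Sum using (inj₁; inj₂; [_,_])
open import Function using (_∘_)
open import Function.Bundles using (mk⇔; Equivalence)
open import Relation.Nullary using (¬_; yes; no; contradiction)
open import Relation.Binary.PropositionalEquality
  using (_≡_; _≢_; refl; sym; trans; cong; cong₂; subst; module ≡-Reasoning)

∣p∪⁅x⁆∣≡1+∣p∣ : ∀ {n} (p : Subset n) {x} → x ∉ p → ∣ p ∪ ⁅ x ⁆ ∣ ≡ suc ∣ p ∣
∣p∪⁅x⁆∣≡1+∣p∣ (inside  ∷ p) {zero}  x∉p = contradiction here x∉p
∣p∪⁅x⁆∣≡1+∣p∣ (outside ∷ p) {zero}  _   = cong (suc ∘ ∣_∣) (∪-identityʳ p)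
∣p∪⁅x⁆∣≡1+∣p∣ (inside  ∷ p) {suc x} x∉p = cong suc (∣p∪⁅x⁆∣≡1+∣p∣ p (x∉p ∘ there))
∣p∪⁅x⁆∣≡1+∣p∣ (outside ∷ p) {suc x} x∉p = ∣p∪⁅x⁆∣≡1+∣p∣ p (x∉p ∘ there)

∣⁅x⁆∪p∣≤1+∣p∣ : ∀ {n} (x : Fin n) (p : Subset n) → ∣ ⁅ x ⁆ ∪ p ∣ ≤ suc ∣ p ∣
∣⁅x⁆∪p∣≤1+∣p∣ zero    (inside  ∷ p) = s≤s (m≤n⇒m≤1+n (≤-reflexive (cong ∣_∣ (∪-identityˡ p))))
∣⁅x⁆∪p∣≤1+∣p∣ zero    (outside ∷ p) = s≤s (≤-reflexive (cong ∣_∣ (∪-identityˡ p)))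
∣⁅x⁆∪p∣≤1+∣p∣ (suc x) (inside  ∷ p) = s≤s (∣⁅x⁆∪p∣≤1+∣p∣ x p)
∣⁅x⁆∪p∣≤1+∣p∣ (suc x) (outside ∷ p) = ∣⁅x⁆∪p∣≤1+∣p∣ x p

∣p∣>0⇒Nonempty : ∀ {n} (p : Subset n) → 0 < ∣ p ∣ → Nonempty p
∣p∣>0⇒Nonempty {n} p 0<∣p∣ with nonempty? p
... | yes p≢∅ = p≢∅
... | no  p≡∅ = contradiction (trans (cong ∣_∣ (Empty-unique p≡∅)) (∣⊥∣≡0 n)) (>⇒≢ 0<∣p∣)

∣p∣<n⇒∃∉ : ∀ {n} (p : Subset n) → ∣ p ∣ < n → ∃ λ x → x ∉ p
∣p∣<n⇒∃∉ {n} p ∣p∣<n = map₂ x∈∁p⇒x∉p (∣p∣>0⇒Nonempty (∁ p) 0<∣∁p∣)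
  where
  0<∣∁p∣ : 0 < ∣ ∁ p ∣
  0<∣∁p∣ = subst (0 <_) (sym (∣∁p∣≡n∸∣p∣ p)) (m<n⇒0<n∸m ∣p∣<n)

∈-toSet⁺ : ∀ {n} {v : Fin n} {xs} → v ∈ₗ xs → v ∈ₛ toSet xs
∈-toSet⁺ {xs = x ∷ _} (here refl)  = x∈p∪q⁺ (inj₁ (x∈⁅x⁆ x))
∈-toSet⁺              (there v∈xs) = x∈p∪q⁺ (inj₂ (∈-toSet⁺ v∈xs))

∈-toSet⁻ : ∀ {n} {v : Fin n} xs → v ∈ₛ toSet xs → v ∈ₗ xs
∈-toSet⁻ []       v∈∅ = contradiction v∈∅ ∉⊥
∈-toSet⁻ (x ∷ xs) v∈  with x∈p∪q⁻ ⁅ x ⁆ (toSet xs) v∈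
... | inj₁ v∈⁅x⁆ = here (x∈⁅y⁆⇒x≡y x v∈⁅x⁆)
... | inj₂ v∈xs  = there (∈-toSet⁻ xs v∈xs)

toSet-⊆ : ∀ {n} {xs ys : List (Fin n)} → xs ⊆ₗ ys → toSet xs ⊆ toSet ys
toSet-⊆ {xs = xs} xs⊆ys = ∈-toSet⁺ ∘ xs⊆ys ∘ ∈-toSet⁻ xs

toSet-++ : ∀ {n} (xs ys : List (Fin n)) → toSet (xs ++ ys) ≡ toSet xs ∪ toSet ys
toSet-++ []       ys = sym (∪-identityˡ (toSet ys))
toSet-++ (x ∷ xs) ys = trans (cong (⁅ x ⁆ ∪_) (toSet-++ xs ys)) (sym (∪-assoc ⁅ x ⁆ (toSet xs) (toSet ys)))

toSet-∷ʳ : ∀ {n} (xs : List (Fin n)) x → toSet (xs ∷ʳ x) ≡ toSet (x ∷ xs)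
toSet-∷ʳ xs x = begin
  toSet (xs ++ x ∷ [])     ≡⟨ toSet-++ xs (x ∷ []) ⟩
  toSet xs ∪ (⁅ x ⁆ ∪ ∅)  ≡⟨ cong (toSet xs ∪_) (∪-identityʳ ⁅ x ⁆) ⟩
  toSet xs ∪ ⁅ x ⁆        ≡⟨ ∪-comm (toSet xs) ⁅ x ⁆ ⟩
  ⁅ x ⁆ ∪ toSet xs        ∎
  where open ≡-Reasoning

∣toSet∣≤length : ∀ {n} (xs : List (Fin n)) → ∣ toSet xs ∣ ≤ length xs
∣toSet∣≤length {n} []       = ≤-reflexive (∣⊥∣≡0 n)
∣toSet∣≤length     (x ∷ xs) = ≤-trans (∣⁅x⁆∪p∣≤1+∣p∣ x (toSet xs)) (s≤s (∣toSet∣≤length xs))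

elements : ∀ {n} → Subset n → List (Fin n)
elements []            = []
elements (inside  ∷ p) = zero ∷ map suc (elements p)
elements (outside ∷ p) = map suc (elements p)

toSet-map-suc : ∀ {n} (xs : List (Fin n)) → toSet (map suc xs) ≡ outside ∷ toSet xs
toSet-map-suc []       = refl
toSet-map-suc (x ∷ xs) = cong (⁅ suc x ⁆ ∪_) (toSet-map-suc xs)

toSet-elements : ∀ {n} (p : Subset n) → toSet (elements p) ≡ p
toSet-elements []            = refl
toSet-elements (inside  ∷ p) = trans (cong (⁅ zero ⁆ ∪_) (toSet-map-suc (elements p)))
                                     (cong (inside ∷_) (trans (∪-identityˡ _) (toSet-elements p)))
toSet-elements (outside ∷ p) = trans (toSet-map-suc (elements p)) (cong (outside ∷_) (toSet-elements p))

length-elements : ∀ {n} (p : Subset n) → length (elements p) ≡ ∣ p ∣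
length-elements []            = refl
length-elements (inside  ∷ p) = cong suc (trans (length-map suc (elements p)) (length-elements p))
length-elements (outside ∷ p) = trans (length-map suc (elements p)) (length-elements p)

module _ {A : Set} where

  windows-∷ : ∀ k (x : A) xs → k ≤ length (x ∷ xs) → windows k (x ∷ xs) ≡ take k (x ∷ xs) ∷ windows k xs
  windows-∷ k x xs k≤l with k ≤? length (x ∷ xs)
  ... | yes _   = refl
  ... | no  k≰l = contradiction k≤l k≰l

  windows-short : ∀ k (xs : List A) → length xs < k → windows k xs ≡ []
  windows-short k []       _   = refl
  windows-short k (x ∷ xs) l<k with k ≤? length (x ∷ xs)
  ... | yes k≤l = contradiction (≤-trans l<k k≤l) 1+n≰n
  ... | no  _   = refl

  windows-exact : ∀ k (xs : List A) → length xs ≡ suc k → windows (suc k) xs ≡ xs ∷ []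
  windows-exact k (x ∷ xs) refl = begin
    windows (suc k) (x ∷ xs)                      ≡⟨ windows-∷ (suc k) x xs ≤-refl ⟩
    take (suc k) (x ∷ xs) ∷ windows (suc k) xs    ≡⟨ cong₂ _∷_ (take-all (suc k) (x ∷ xs) ≤-refl)
                                                                (windows-short (suc k) xs ≤-refl) ⟩
    (x ∷ xs) ∷ []                                  ∎
    where open ≡-Reasoning

  take-length-++ : ∀ (xs ys : List A) → take (length xs) (xs ++ ys) ≡ xs
  take-length-++ []       ys = refl
  take-length-++ (x ∷ xs) ys = cong (x ∷_) (take-length-++ xs ys)

  windows-∷-++ : ∀ x (xs ys : List A) →
    windows (suc (length xs)) (x ∷ xs ++ ys) ≡ (x ∷ xs) ∷ windows (suc (length xs)) (xs ++ ys)
  windows-∷-++ x xs ys = trans (windows-∷ _ x (xs ++ ys) (s≤s (length-++-≤ˡ xs)))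
                               (cong (λ w → (x ∷ w) ∷ windows (suc (length xs)) (xs ++ ys)) (take-length-++ xs ys))

  windows-∷-∷ʳ : ∀ x (xs : List A) y → windows (suc (length xs)) (x ∷ (xs ∷ʳ y)) ≡ (x ∷ xs) ∷ (xs ∷ʳ y) ∷ []
  windows-∷-∷ʳ x xs y = trans (windows-∷-++ x xs (y ∷ []))
                              (cong ((x ∷ xs) ∷_) (windows-exact _ (xs ∷ʳ y) length-∷ʳ))
    where
    length-∷ʳ : length (xs ∷ʳ y) ≡ suc (length xs)
    length-∷ʳ = trans (length-++-sucʳ xs y []) (cong (suc ∘ length) (++-identityʳ xs))

  take-⊆ : ∀ k (xs : List A) → take k xs ⊆ₗ xs
  take-⊆ (suc k) (x ∷ xs) (here v≡x)  = here v≡x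
  take-⊆ (suc k) (x ∷ xs) (there v∈) = there (take-⊆ k xs v∈)

  ∈-windows⇒⊆ : ∀ k (xs : List A) {ys} → ys ∈ₗ windows k xs → ys ⊆ₗ xs
  ∈-windows⇒⊆ k (x ∷ xs) ys∈ with k ≤? length (x ∷ xs)
  ∈-windows⇒⊆ k (x ∷ xs) (here refl) | yes _ = take-⊆ k (x ∷ xs)
  ∈-windows⇒⊆ k (x ∷ xs) (there ys∈) | yes _ = there ∘ ∈-windows⇒⊆ k xs ys∈

  -- If the tail is shorter than a window, the first window is the whole list.
  ∈⇒∈-windows : ∀ k (xs : List A) {v} → suc k ≤ length xs → v ∈ₗ xs → Any (v ∈ₗ_) (windows (suc k) xs)
  ∈⇒∈-windows k (x ∷ xs) {v} k<l v∈ rewrite windows-∷ (suc k) x xs k<l with v∈ | suc k ≤? length xs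
  ... | here v≡x   | _          = here (here v≡x)
  ... | there v∈xs | yes k<l′   = there (∈⇒∈-windows k xs k<l′ v∈xs)
  ... | there v∈xs | no  k≮l′   = here (subst (v ∈ₗ_) (sym (take-all (suc k) (x ∷ xs) (s≤s (≮⇒≥ k≮l′)))) (there v∈xs))

  windows-three : ∀ k (x y z : A) zs → k ≤ length (z ∷ zs) →
    windows k (x ∷ y ∷ z ∷ zs) ≡ take k (x ∷ y ∷ z ∷ zs) ∷ take k (y ∷ z ∷ zs) ∷ take k (z ∷ zs) ∷ windows k zs
  windows-three k x y z zs k≤l =
    trans (windows-∷ k x (y ∷ z ∷ zs) (m≤n⇒m≤1+n (m≤n⇒m≤1+n k≤l)))
          (cong (take k (x ∷ y ∷ z ∷ zs) ∷_)
            (trans (windows-∷ k y (z ∷ zs) (m≤n⇒m≤1+n k≤l))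
                   (cong (take k (y ∷ z ∷ zs) ∷_) (windows-∷ k z zs k≤l))))

  take-⊆-take-suc : ∀ k (xs : List A) → take k xs ⊆ₗ take (suc k) xs
  take-⊆-take-suc (suc k) (x ∷ xs) (here v≡x) = here v≡x
  take-⊆-take-suc (suc k) (x ∷ xs) (there v∈) = there (take-⊆-take-suc k xs v∈)

  middle-window-⊆ : ∀ k (x y : A) zs →
    take (suc (suc k)) (y ∷ zs) ⊆ₗ take (suc (suc k)) (x ∷ y ∷ zs) ++ take (suc (suc k)) zs
  middle-window-⊆ k x y zs (here v≡y) = ∈-++⁺ˡ {ys = take (suc (suc k)) zs} (there (here v≡y))
  middle-window-⊆ k x y zs (there v∈) = ∈-++⁺ʳ (x ∷ y ∷ take k zs) (take-⊆-take-suc (suc k) zs v∈)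

  prefix-of-length : ∀ k (xs : List A) → k ≤ length xs → ∃₂ λ ys zs → length ys ≡ k × xs ≡ ys ++ zs
  prefix-of-length zero    xs       _         = [] , xs , refl , refl
  prefix-of-length (suc k) (x ∷ xs) (s≤s k≤l) with prefix-of-length k xs k≤l
  ... | ys , zs , refl , refl = x ∷ ys , zs , refl , refl

  lastOf-∈ : ∀ (x : A) xs → lastOf x xs ∈ₗ x ∷ xs
  lastOf-∈ x []       = here refl
  lastOf-∈ x (y ∷ xs) = there (lastOf-∈ y xs)

  lastOf-∈-tail : ∀ (x : A) xs → 1 ≤ length xs → lastOf x xs ∈ₗ xs
  lastOf-∈-tail x (y ∷ xs) _ = lastOf-∈ y xs

  lastOf-∷ʳ : ∀ (x : A) xs y → lastOf x (xs ∷ʳ y) ≡ y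
  lastOf-∷ʳ x []       y = refl
  lastOf-∷ʳ x (z ∷ xs) y = lastOf-∷ʳ z xs y

windowSets : ∀ {n} → ℕ → List (Fin n) → List (Subset n)
windowSets k xs = map toSet (windows k xs)

WindowsAreEdges : ∀ {n} → Hypergraph n → ℕ → List (Fin n) → Set
WindowsAreEdges H k xs = ∀ e → e ∈ₗ windowSets k xs → Edge H e

spannedBy : ∀ {n} (H : Hypergraph n) k xs → WindowsAreEdges H k xs → SubHypergraph H
spannedBy H k xs windowsAreEdges = record
  { W   = toSet xs
  ; F   = _∈ₗ windowSets k xs
  ; F⊆E = windowsAreEdges
  ; F⊆W = window⊆
  }
  where
  window⊆ : ∀ e → e ∈ₗ windowSets k xs → e ⊆ toSet xs
  window⊆ e e∈ with ∈-map⁻ toSet e∈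
  ... | ys , ys∈ , refl = toSet-⊆ (∈-windows⇒⊆ k xs ys∈)

Joins : ∀ {n} → ℕ → Hypergraph n → Fin n → Fin n → Set₁
Joins k H x y = ∃ λ (S : SubHypergraph H) → x ∈ₛ W S × y ∈ₛ W S × IsChain k (W S) (F S)

chainSequence-joins : ∀ {n} {H : Hypergraph n} {k} v vs → WindowsAreEdges H k (v ∷ vs) →
  k ≤ length (v ∷ vs) → Unique (windowSets k (v ∷ vs)) → v ≢ lastOf v vs →
  ∀ {x y} → x ∈ₗ v ∷ vs → y ∈ₗ v ∷ vs → Joins k H x y
chainSequence-joins {H = H} {k} v vs windowsAreEdges k≤l distinct v≢last x∈ y∈ =
  spannedBy H k (v ∷ vs) windowsAreEdges , ∈-toSet⁺ x∈ , ∈-toSet⁺ y∈ ,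
  (v , vs , (λ _ → mk⇔ (∈-toSet⁻ (v ∷ vs)) ∈-toSet⁺) , k≤l , distinct , (λ _ → mk⇔ (λ e∈ → e∈) (λ e∈ → e∈)) , v≢last)

IsChain-covers : ∀ {n k} {W : Subset n} {F} → IsChain (suc k) W F → ∀ {v} → v ∈ₛ W → ∃ λ e → F e × v ∈ₛ e
IsChain-covers (v₁ , vs , W⇔ , k<l , _ , F⇔ , _) v∈W
  with find (∈⇒∈-windows _ (v₁ ∷ vs) k<l (Equivalence.to (W⇔ _) v∈W))
... | ys , ys∈ , v∈ys = toSet ys , Equivalence.from (F⇔ _) (∈-map⁺ toSet ys∈) , ∈-toSet⁺ v∈ys

chainConnected⇒nonIsolated : ∀ {n k} {H : Hypergraph n} → ChainConnected (suc k) H →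
  ∀ {x y} → x ≢ y → ∃ λ e → Edge H e × x ∈ₛ e
chainConnected⇒nonIsolated connected x≢y with connected _ _ x≢y
... | S , x∈W , _ , chain with IsChain-covers chain x∈W
... | e , e∈F , x∈e = e , F⊆E S e e∈F , x∈e

tightStar-uniform : ∀ {n} (U : Subset n) → IsUniform (suc ∣ U ∣) (tightStar U)
tightStar-uniform U _ (w , w∉U , refl) = ∣p∪⁅x⁆∣≡1+∣p∣ U w∉U

tightStar-∩⊆centre : ∀ {n} (U : Subset n) {e e′ x} → Edge (tightStar U) e → Edge (tightStar U) e′ →
  e ≢ e′ → x ∈ₛ e → x ∈ₛ e′ → x ∈ₛ U
tightStar-∩⊆centre U (a , _ , refl) (b , _ , refl) e≢e′ x∈e x∈e′
  with x∈p∪q⁻ U ⁅ a ⁆ x∈e | x∈p∪q⁻ U ⁅ b ⁆ x∈e′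
... | inj₁ x∈U | _         = x∈U
... | inj₂ _   | inj₁ x∈U  = x∈U
... | inj₂ x≡a | inj₂ x≡b  =
  contradiction (cong (λ w → U ∪ ⁅ w ⁆) (trans (sym (x∈⁅y⁆⇒x≡y a x≡a)) (x∈⁅y⁆⇒x≡y b x≡b))) e≢e′

tightStar-¬middle⊆ : ∀ {n} (U : Subset n) {e₁ e₂ e₃} →
  Edge (tightStar U) e₁ → Edge (tightStar U) e₂ → Edge (tightStar U) e₃ →
  e₁ ≢ e₂ → e₂ ≢ e₃ → ¬ (e₂ ⊆ e₁ ∪ e₃)
tightStar-¬middle⊆ U E₁ E₂@(b , b∉U , refl) E₃ e₁≢e₂ e₂≢e₃ e₂⊆e₁∪e₃ =
  b∉U ([ (λ b∈e₁ → tightStar-∩⊆centre U E₁ E₂ e₁≢e₂ b∈e₁ b∈e₂)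
       , (λ b∈e₃ → tightStar-∩⊆centre U E₂ E₃ e₂≢e₃ b∈e₂ b∈e₃)
       ] (x∈p∪q⁻ _ _ (e₂⊆e₁∪e₃ b∈e₂)))
  where b∈e₂ = x∈p∪q⁺ (inj₂ (x∈⁅x⁆ b))

tightStar-deleteEdge-isolates : ∀ {n} {U : Subset n} {w} → w ∉ U →
  ¬ (∃ λ e → Edge (deleteEdge (tightStar U) (U ∪ ⁅ w ⁆)) e × w ∈ₛ e)
tightStar-deleteEdge-isolates {U = U} w∉U (_ , ((b , _ , refl) , e≢f) , w∈e) with x∈p∪q⁻ U ⁅ b ⁆ w∈e
... | inj₁ w∈U   = w∉U w∈U
... | inj₂ w∈⁅b⁆ = e≢f (cong (λ x → U ∪ ⁅ x ⁆) (sym (x∈⁅y⁆⇒x≡y b w∈⁅b⁆)))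

tightStar-edgeMinimal : ∀ {n k} {U : Subset n} → Nonempty U →
  ∀ f → Edge (tightStar U) f → ¬ IsHypertree (suc k) (deleteEdge (tightStar U) f)
tightStar-edgeMinimal (u , u∈U) _ (w , w∉U , refl) (connected , _) =
  tightStar-deleteEdge-isolates w∉U (chainConnected⇒nonIsolated connected w≢u)
  where
  w≢u : w ≢ u
  w≢u refl = w∉U u∈U

module _ {n} {U : Subset n} {L : List (Fin n)} (L≡U : toSet L ≡ U) (L≢[] : 1 ≤ length L) where

  ∈U⇒∈L : ∀ {v} → v ∈ₛ U → v ∈ₗ L
  ∈U⇒∈L v∈U = ∈-toSet⁻ L (subst (_ ∈ₛ_) (sym L≡U) v∈U)

  tightStar-edge-∷ : ∀ {w} → w ∉ U → Edge (tightStar U) (toSet (w ∷ L))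
  tightStar-edge-∷ {w} w∉U = w , w∉U , trans (cong (⁅ w ⁆ ∪_) L≡U) (∪-comm ⁅ w ⁆ U)

  ∉U⇒≢lastOf : ∀ {w} → w ∉ U → w ≢ lastOf w L
  ∉U⇒≢lastOf {w} w∉U w≡last =
    w∉U (subst (w ∈ₛ_) L≡U (∈-toSet⁺ (subst (_∈ₗ L) (sym w≡last) (lastOf-∈-tail w L L≢[]))))

  oneEdge-joins : ∀ {w x y} → w ∉ U → x ∈ₗ w ∷ L → y ∈ₗ w ∷ L → Joins (suc (length L)) (tightStar U) x y
  oneEdge-joins {w} w∉U =
    chainSequence-joins w L windowsAreEdges ≤-refl (subst (Unique ∘ map toSet) (sym windows≡) ([] ∷ []))
      (∉U⇒≢lastOf w∉U)
    where
    windows≡ : windows (suc (length L)) (w ∷ L) ≡ (w ∷ L) ∷ []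
    windows≡ = windows-exact (length L) (w ∷ L) refl
    windowsAreEdges : WindowsAreEdges (tightStar U) (suc (length L)) (w ∷ L)
    windowsAreEdges e e∈ with subst (e ∈ₗ_) (cong (map toSet) windows≡) e∈
    ... | here refl = tightStar-edge-∷ w∉U

  twoEdge-joins : ∀ {w₁ w₂ x y} → w₁ ∉ U → w₂ ∉ U → w₁ ≢ w₂ →
    x ∈ₗ w₁ ∷ (L ∷ʳ w₂) → y ∈ₗ w₁ ∷ (L ∷ʳ w₂) → Joins (suc (length L)) (tightStar U) x y
  twoEdge-joins {w₁} {w₂} w₁∉U w₂∉U w₁≢w₂ =
    chainSequence-joins w₁ (L ∷ʳ w₂) windowsAreEdges (s≤s (length-++-≤ˡ L))
      (subst (Unique ∘ map toSet) (sym windows≡) ((edges≢ ∷ []) ∷ [] ∷ []))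
      (λ w₁≡last → w₁≢w₂ (trans w₁≡last (lastOf-∷ʳ w₁ L w₂)))
    where
    windows≡ = windows-∷-∷ʳ w₁ L w₂
    edges≢ : toSet (w₁ ∷ L) ≢ toSet (L ∷ʳ w₂)
    edges≢ eq with ∈-++⁻ L (∈-toSet⁻ (L ∷ʳ w₂) (subst (w₁ ∈ₛ_) eq (∈-toSet⁺ {xs = w₁ ∷ L} (here refl))))
    ... | inj₁ w₁∈L        = w₁∉U (subst (w₁ ∈ₛ_) L≡U (∈-toSet⁺ w₁∈L))
    ... | inj₂ (here w₁≡w₂) = w₁≢w₂ w₁≡w₂
    windowsAreEdges : WindowsAreEdges (tightStar U) (suc (length L)) (w₁ ∷ (L ∷ʳ w₂))
    windowsAreEdges e e∈ with subst (e ∈ₗ_) (cong (map toSet) windows≡) e∈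
    ... | here refl         = tightStar-edge-∷ w₁∉U
    ... | there (here refl) = subst (Edge (tightStar U)) (sym (toSet-∷ʳ L w₂)) (tightStar-edge-∷ w₂∉U)

  tightStar-chainConnected-listing : (∃ λ w → w ∉ U) → ChainConnected (suc (length L)) (tightStar U)
  tightStar-chainConnected-listing (w , w∉U) x y x≢y with x ∈? U | y ∈? U
  ... | yes x∈U | yes y∈U = oneEdge-joins w∉U (there (∈U⇒∈L x∈U)) (there (∈U⇒∈L y∈U))
  ... | yes x∈U | no  y∉U = oneEdge-joins y∉U (there (∈U⇒∈L x∈U)) (here refl)
  ... | no  x∉U | yes y∈U = oneEdge-joins x∉U (here refl) (there (∈U⇒∈L y∈U))
  ... | no  x∉U | no  y∉U = twoEdge-joins x∉U y∉U x≢y (here refl) (there (∈-++⁺ʳ L (here refl)))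

tightStar-chainConnected : ∀ {n} (U : Subset n) → 0 < ∣ U ∣ → ∣ U ∣ < n → ChainConnected (suc ∣ U ∣) (tightStar U)
tightStar-chainConnected U 0<∣U∣ ∣U∣<n =
  subst (λ k → ChainConnected (suc k) (tightStar U)) (length-elements U)
    (tightStar-chainConnected-listing {L = elements U} (toSet-elements U)
       (subst (0 <_) (sym (length-elements U)) 0<∣U∣) (∣p∣<n⇒∃∉ U ∣U∣<n))

tightStar-¬threeWindows : ∀ {n} (U : Subset n) k x y zs → suc (suc k) ≤ length zs →
  WindowsAreEdges (tightStar U) (suc (suc k)) (x ∷ y ∷ zs) → ¬ Unique (windowSets (suc (suc k)) (x ∷ y ∷ zs))
tightStar-¬threeWindows U k x y (z ∷ zs) k≤l windowsAreEdges distinct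
  with subst (Unique ∘ map toSet) (windows-three (suc (suc k)) x y z zs k≤l) distinct
... | (A≢B ∷ _) ∷ (B≢C ∷ _) ∷ _ =
  tightStar-¬middle⊆ U (edgeAt (here refl)) (edgeAt (there (here refl))) (edgeAt (there (there (here refl))))
    A≢B B≢C (subst (toSet B ⊆_) (toSet-++ A C) (toSet-⊆ (middle-window-⊆ k x y (z ∷ zs))))
  where
  K = suc (suc k)
  A = take K (x ∷ y ∷ z ∷ zs)
  B = take K (y ∷ z ∷ zs)
  C = take K (z ∷ zs)
  edgeAt : ∀ {ys} → ys ∈ₗ A ∷ B ∷ C ∷ windows K zs → Edge (tightStar U) (toSet ys)
  edgeAt {ys} ys∈ = windowsAreEdges _ (∈-map⁺ toSet (subst (ys ∈ₗ_) (sym (windows-three K x y z zs k≤l)) ys∈))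

tightStar-¬closed : ∀ {n} (U : Subset n) K v M R → length M ≡ K → 1 ≤ K → IsUniform (suc K) (tightStar U) →
  WindowsAreEdges (tightStar U) (suc K) (v ∷ M ++ R) → Unique (windowSets (suc K) (v ∷ M ++ R)) →
  v ≢ lastOf v (M ++ R)
tightStar-¬closed U _ v [] R refl ()
tightStar-¬closed U _ v (m ∷ M) [] refl _ uniform windowsAreEdges _ v≡last = 1+n≰n (begin
  suc (length (m ∷ M))     ≡⟨ uniform _ firstEdge ⟨
  ∣ toSet (v ∷ m ∷ M) ∣    ≤⟨ p⊆q⇒∣p∣≤∣q∣ (toSet-⊆ v∷M⊆M) ⟩
  ∣ toSet (m ∷ M) ∣        ≤⟨ ∣toSet∣≤length (m ∷ M) ⟩
  length (m ∷ M)           ∎)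
  where
  open ≤-Reasoning
  firstEdge : Edge (tightStar U) (toSet (v ∷ m ∷ M))
  firstEdge = windowsAreEdges _ (subst (λ ws → toSet (v ∷ m ∷ M) ∈ₗ map toSet ws)
                                       (sym (windows-∷-++ v (m ∷ M) [])) (here refl))
  v∈M : v ∈ₗ m ∷ M
  v∈M = subst (v ∈ₗ_) (++-identityʳ (m ∷ M)) (subst (_∈ₗ m ∷ M ++ []) (sym v≡last) (lastOf-∈ m (M ++ [])))
  v∷M⊆M : v ∷ m ∷ M ⊆ₗ m ∷ M
  v∷M⊆M (here refl) = v∈M
  v∷M⊆M (there u∈M) = u∈M
tightStar-¬closed U _ v (m ∷ M) (y ∷ []) refl _ _ _ distinct v≡last
  with subst (Unique ∘ map toSet) (windows-∷-∷ʳ v (m ∷ M) y) distinct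
... | (first≢second ∷ []) ∷ _ =
  first≢second (trans (cong (λ u → toSet (u ∷ m ∷ M)) v≡y) (sym (toSet-∷ʳ (m ∷ M) y)))
  where
  v≡y : v ≡ y
  v≡y = trans v≡last (lastOf-∷ʳ v (m ∷ M) y)
tightStar-¬closed U _ v (m ∷ M) (y ∷ z ∷ R) refl _ _ windowsAreEdges distinct _ =
  tightStar-¬threeWindows U (length M) v m (M ++ y ∷ z ∷ R) long windowsAreEdges distinct
  where
  open ≤-Reasoning
  long : suc (suc (length M)) ≤ length (M ++ y ∷ z ∷ R)
  long = begin
    suc (suc (length M))         ≤⟨ s≤s (s≤s (length-++-≤ˡ M)) ⟩
    suc (suc (length (M ++ R)))  ≡⟨ cong suc (length-++-sucʳ M z R) ⟨
    suc (length (M ++ z ∷ R))    ≡⟨ length-++-sucʳ M y (z ∷ R) ⟨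
    length (M ++ y ∷ z ∷ R)      ∎

tightStar-semicycleFree : ∀ {n} (U : Subset n) → 0 < ∣ U ∣ → SemicycleFree (suc ∣ U ∣) (tightStar U)
tightStar-semicycleFree U 0<∣U∣ S (v , vs , _ , k≤l , distinct , F⇔ , v≡last)
  with prefix-of-length ∣ U ∣ vs (≤-pred k≤l)
... | M , R , ∣M∣≡∣U∣ , refl =
  tightStar-¬closed U ∣ U ∣ v M R ∣M∣≡∣U∣ 0<∣U∣ (tightStar-uniform U) windowsAreEdges distinct v≡last
  where
  windowsAreEdges : WindowsAreEdges (tightStar U) (suc ∣ U ∣) (v ∷ M ++ R)
  windowsAreEdges e e∈ = F⊆E S e (Equivalence.from (F⇔ e) e∈)

tightStar-isEdgeMinimalHypertree : ∀ {n} (U : Subset n) → 0 < ∣ U ∣ → ∣ U ∣ < n →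
  IsUniform (suc ∣ U ∣) (tightStar U) × IsEdgeMinimalHypertree (suc ∣ U ∣) (tightStar U)
tightStar-isEdgeMinimalHypertree U 0<∣U∣ ∣U∣<n =
  tightStar-uniform U ,
  (tightStar-chainConnected U 0<∣U∣ ∣U∣<n , tightStar-semicycleFree U 0<∣U∣) ,
  tightStar-edgeMinimal (∣p∣>0⇒Nonempty U 0<∣U∣)

mainTheorem6 : (k n : ℕ) → 2 ≤ k → k ≤ n → (U : Subset n) → ∣ U ∣ ≡ k ∸ 1 →
    IsUniform k (tightStar U) × IsEdgeMinimalHypertree k (tightStar U)
mainTheorem6 (suc (suc j)) n (s≤s (s≤s z≤n)) k≤n U ∣U∣≡1+j =
  subst (λ k → IsUniform k (tightStar U) × IsEdgeMinimalHypertree k (tightStar U)) (cong suc ∣U∣≡1+j)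
    (tightStar-isEdgeMinimalHypertree U (subst (0 <_) (sym ∣U∣≡1+j) (s≤s z≤n)) (subst (_< n) (sym ∣U∣≡1+j) k≤n))
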